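{- Let $\mathcal{S}=\langle S,s_0,\tau,l\rangle$ be a $\Gamma$-labeled $\Upsilon$-transition system, let $n,m\ge 0$, and let $\varphi$ be a quantifier-free HyperLTL formula. (1) Consider the formula $\forall \pi_1 \ldots \forall \pi_n.\ \exists \pi_1' \ldots \exists \pi_m'.\ \varphi$, where the free trace variables of $\varphi$ are among $\pi_1,\dots,\pi_n,\pi_1',\dots,\pi_m'$. Suppose there is a strategy $\sigma\colon (\Upsilon^n)^*\to\Upsilon^m$ with the following property: for every infinite sequence $u=u_0u_1u_2\ldots\in(\Upsilon^n)^\omega$, writing $u_i=(u_i^1,\dots,u_i^n)$ and $v_i=\sigma(u_0\cdots u_{i-1})=(v_i^1,\dots,v_i^m)\in\Upsilon^m$ for all $i\ge 0$, and letting $\rho_j$ be the trace of $\mathcal{S}$ on the input word $u_0^ju_1^ju_2^j\ldots$ ($1\le j\le n$) and $\rho'_k$ the trace of $\mathcal{S}$ on the input word $v_0^kv_1^kv_2^k\ldots$ ($1\le k\le m$), the assignment $\Pi$ with $\Pi(\pi_j)=\rho_j$ and $\Pi(\pi'_k)=\rho'_k$ satisfies $\Pi,0\models\varphi$. Then $\mathcal{S}\models \forall \pi_1 \ldots \forall \pi_n.\ \exists \pi_1' \ldots \exists \pi_m'.\ \varphi$. (2) Consider the formula $\exists \pi_1 \ldots \exists \pi_m.\ \forall \pi_1' \ldots \forall \pi_n'.\ \varphi$, where the free trace variables of $\varphi$ are among $\pi_1,\dots,\pi_m,\pi_1',\dots,\pi_n'$. Suppose there is a strategy $\sigma\colon(\Upsilon^0)^*\to\Upsilon^m$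 (since $\Upsilon^0$ is a singleton, $\sigma$ amounts to an infinite sequence $w=w_0w_1\ldots\in(\Upsilon^m)^\omega$, $w_i$ being the value of $\sigma$ on the unique history of length $i$) with the following property: writing $w_i=(w_i^1,\dots,w_i^m)$ and letting $\rho_k$ be the trace of $\mathcal{S}$ on $w_0^kw_1^k\ldots$ ($1\le k\le m$), for all traces $\rho'_1,\dots,\rho'_n\in\mathit{traces}(\mathcal{S})$ the assignment $\Pi$ with $\Pi(\pi_k)=\rho_k$, $\Pi(\pi'_j)=\rho'_j$ satisfies $\Pi,0\models\varphi$. Then $\mathcal{S}\models \exists \pi_1 \ldots \exists \pi_m.\ \forall \pi_1' \ldots \forall \pi_n'.\ \varphi$.
   Context: Let $I$ and $O$ be disjoint finite sets of input and output propositions, $\Upsilon=2^I$, $\Gamma=2^O$, $\mathrm{AP}=I\cup O$, $\Sigma=2^{\mathrm{AP}}$. A $\Gamma$-labeled $\Upsilon$-transition system is $\mathcal{S}=\langle S,s_0,\tau,l\rangle$ with $S$ finite, $s_0\in S$, $\tau\colon S\times\Upsilon\to S$, $l\colon S\to\Gamma$. Extend $\tau$ to $\tau^*\colon\Upsilon^*\to S$ by $\tau^*(\epsilon)=s_0$ and $\tau^*(x\upsilon)=\tau(\tau^*(x),\upsilon)$. The trace of $\mathcal{S}$ on an input word $\upsilon_0\upsilon_1\ldots\in\Upsilon^\omega$ is $(\upsilon_0\cup\gamma_0)(\upsilon_1\cup\gamma_1)\ldots\in\Sigma^\omega$ where $\gamma_i=l(\tau^*(\upsilon_0\cdots\upsilon_{i-1}))$;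 $\mathit{traces}(\mathcal{S})$ is the set of all such traces. A strategy is any function $\sigma\colon(\Upsilon^n)^*\to\Upsilon^m$. HyperLTL formulas over trace variables are given by $\varphi::=\forall\pi.\varphi\mid\exists\pi.\varphi\mid\psi$, $\psi::=a_\pi\mid\neg\psi\mid\psi\vee\psi\mid \mathsf{X}\psi\mid\psi\,\mathsf{U}\,\psi$ ($a\in\mathrm{AP}$), with the usual derived operators ($\wedge,\rightarrow,\leftrightarrow$, $\mathsf{F}\psi=\mathit{true}\,\mathsf{U}\,\psi$, $\mathsf{G}\psi=\neg\mathsf{F}\neg\psi$, etc.). Semantics w.r.t. a trace set $Tr$, an assignment $\Pi$ of traces to trace variables, and a position $i$: $\Pi,i\models a_\pi$ iff $a\in\Pi(\pi)[i]$; Boolean connectives as usual; $\Pi,i\models\mathsf{X}\psi$ iff $\Pi,i+1\models\psi$; $\Pi,i\models\psi_1\mathsf{U}\psi_2$ iff there is $j\ge i$ with $\Pi,j\models\psi_2$ and $\Pi,k\models\psi_1$ for all $i\le k<j$; $\Pi,i\models_{Tr}\exists\pi.\varphi$ iff $\Pi[\pi\mapsto t],i\models_{Tr}\varphi$ for some $t\in Tr$; $\Pi,i\models_{Tr}\forall\pi.\varphi$ iff this holds for all $t\in Tr$. A quantifier-free formula does not depend on $Tr$. $\mathcal{S}\models\varphi$ iff $\emptyset,0\models_{\mathit{traces}(\mathcal{S})}\varphi$ for the empty assignment. -}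

module Defs where

open import Data.Nat using (ℕ; zero; suc; _≤_; _<_)
open import Data.Fin using (Fin)
open import Data.Fin.Properties using () renaming (_≟_ to _≟F_)
open import Data.Bool using (Bool; true)
open import Data.Sum using (_⊎_; inj₁; inj₂; [_,_])
open import Data.Sum.Properties using (≡-dec)
open import Data.Product using (Σ; _×_; _,_)
open import Data.Maybe using (Maybe; just; nothing)
open import Data.List using (List; []; _∷_; foldl; map; applyUpTo; replicate)
open import Data.Empty using (⊥)
open import Relation.Nullary using (¬_; yes; no)
open import Relation.Binary.PropositionalEquality using (_≡_)
open import Relation.Binary.Definitions using (DecidableEquality)

-- Propositions: I = Fin ni (inputs), O = Fin nₒ (outputs), AP = I ⊎ O.
-- Subsets of a finite set are represented as Bool-valued functions.

Υ : ℕ → Set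
Υ ni = Fin ni → Bool

Γ : ℕ → Set
Γ nₒ = Fin nₒ → Bool

AP : ℕ → ℕ → Set
AP ni nₒ = Fin ni ⊎ Fin nₒ

Σ' : ℕ → ℕ → Set
Σ' ni nₒ = AP ni nₒ → Bool

Trace : ℕ → ℕ → Set
Trace ni nₒ = ℕ → Σ' ni nₒ

record TS (ni nₒ : ℕ) : Set where
  field
    states : ℕ
    s₀     : Fin states
    τ      : Fin states → Υ ni → Fin states
    l      : Fin states → Γ nₒ

  τ* : List (Υ ni) → Fin states
  τ* x = foldl τ s₀ x

  trace : (ℕ → Υ ni) → Trace ni nₒ
  trace w i (inj₁ p) = w i p
  trace w i (inj₂ o) = l (τ* (applyUpTo w i)) o

  traces : Trace ni nₒ → Set
  traces t = Σ (ℕ → Υ ni) λ w → t ≡ trace w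

open TS public

data QF (ni nₒ : ℕ) (V : Set) : Set where
  atom  : AP ni nₒ → V → QF ni nₒ V
  ¬'_   : QF ni nₒ V → QF ni nₒ V
  _∨'_  : QF ni nₒ V → QF ni nₒ V → QF ni nₒ V
  X'_   : QF ni nₒ V → QF ni nₒ V
  _U'_  : QF ni nₒ V → QF ni nₒ V → QF ni nₒ V

data HyperLTL (ni nₒ : ℕ) (V : Set) : Set where
  ∀'  : V → HyperLTL ni nₒ V → HyperLTL ni nₒ V
  ∃'  : V → HyperLTL ni nₒ V → HyperLTL ni nₒ V
  qf  : QF ni nₒ V → HyperLTL ni nₒ V

Assignment : ℕ → ℕ → Set → Set
Assignment ni nₒ V = V → Maybe (Trace ni nₒ)

emptyAssignment : ∀ {ni nₒ V} → Assignment ni nₒ V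
emptyAssignment _ = nothing

_[_↦_]⟨_⟩ : ∀ {ni nₒ V} → Assignment ni nₒ V → V → Trace ni nₒ →
            DecidableEquality V → Assignment ni nₒ V
(Π [ π ↦ t ]⟨ _≟_ ⟩) π' with π' ≟ π
... | yes _ = just t
... | no  _ = Π π'

AtomHolds : ∀ {ni nₒ} → Maybe (Trace ni nₒ) → AP ni nₒ → ℕ → Set
AtomHolds nothing  a i = ⊥
AtomHolds (just t) a i = t i a ≡ true

_,_⊨QF_ : ∀ {ni nₒ V} → Assignment ni nₒ V → ℕ → QF ni nₒ V → Set
Π , i ⊨QF atom a π  = AtomHolds (Π π) a i
Π , i ⊨QF (¬' ψ)    = ¬ (Π , i ⊨QF ψ)
Π , i ⊨QF (ψ ∨' χ)  = (Π , i ⊨QF ψ) ⊎ (Π , i ⊨QF χ)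
Π , i ⊨QF (X' ψ)    = Π , suc i ⊨QF ψ
Π , i ⊨QF (ψ U' χ)  =
  Σ ℕ λ j → i ≤ j × (Π , j ⊨QF χ) × (∀ k → i ≤ k → k < j → Π , k ⊨QF ψ)

Sat : ∀ {ni nₒ V} → DecidableEquality V → (Trace ni nₒ → Set) →
      Assignment ni nₒ V → ℕ → HyperLTL ni nₒ V → Set
Sat eq Tr Π i (∀' π φ) = ∀ t → Tr t → Sat eq Tr (Π [ π ↦ t ]⟨ eq ⟩) i φ
Sat eq Tr Π i (∃' π φ) = Σ (Trace _ _) λ t → Tr t × Sat eq Tr (Π [ π ↦ t ]⟨ eq ⟩) i φ
Sat eq Tr Π i (qf ψ)   = Π , i ⊨QF ψ

_⊨_⟨_⟩ : ∀ {ni nₒ V} → TS ni nₒ → HyperLTL ni nₒ V → DecidableEquality V → Set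
S ⊨ φ ⟨ eq ⟩ = Sat eq (traces S) emptyAssignment 0 φ

∀s : ∀ {ni nₒ V} → List V → HyperLTL ni nₒ V → HyperLTL ni nₒ V
∀s []       φ = φ
∀s (x ∷ xs) φ = ∀' x (∀s xs φ)

∃s : ∀ {ni nₒ V} → List V → HyperLTL ni nₒ V → HyperLTL ni nₒ V
∃s []       φ = φ
∃s (x ∷ xs) φ = ∃' x (∃s xs φ)

_≟V_ : ∀ {a b} → DecidableEquality (Fin a ⊎ Fin b)
_≟V_ = ≡-dec _≟F_ _≟F_

-- Strategies σ : (Υ^n)* → Υ^m, with tuples as functions Fin n → Υ.

Strategy : ℕ → ℕ → ℕ → Set
Strategy ni n m = List (Fin n → Υ ni) → (Fin m → Υ ni)

prefix : ∀ {A : Set} → (ℕ → A) → ℕ → List A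
prefix u i = applyUpTo u i

response : ∀ {ni n m} → Strategy ni n m → (ℕ → (Fin n → Υ ni)) → ℕ → (Fin m → Υ ni)
response σ u i = σ (prefix u i)

unit⁰ : ∀ {ni} → Fin 0 → Υ ni
unit⁰ ()

play⁰ : ∀ {ni m} → Strategy ni 0 m → ℕ → (Fin m → Υ ni)
play⁰ σ i = σ (replicate i unit⁰)

module Submission where

-- A block of quantifiers  Q x₁ … Q xₖ  binds the variables ι(0), …, ι(k-1)
-- one after another.  The effect of the whole block on an assignment is
-- captured by 'updateBlock', which binds ι(j) to g(j) for every j.
-- Since a quantifier-free formula only depends on the values of the assignment
-- ('⊨QF-cong'), both parts of the theorem reduce to checking that the two
-- block updates produce the assignment [ρ, ρ'] on which the strategy wins:
-- for ∀∃ the ∃-traces are the system's traces on the strategy's responses to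
-- the input words of the ∀-traces, for ∃∀ they are the traces on the fixed
-- sequence played by the strategy.

open import Defs
open import Data.Nat using (ℕ; zero; suc)
open import Data.Fin using (Fin; zero; suc)
open import Data.Fin.Properties using (0≢1+n; suc-injective)
open import Data.Sum using (_⊎_; inj₁; inj₂; [_,_])
open import Data.Sum.Properties using (inj₁-injective; inj₂-injective)
open import Data.Product using (_×_; Σ; _,_; proj₁; proj₂)
open import Data.Maybe using (just)
open import Data.List using (map; allFin; tabulate)
open import Data.List.Properties using (map-tabulate)
open import Data.Vec.Functional using (_∷_)
open import Data.Empty using (⊥-elim)
open import Function using (_∘_)
open import Function.Definitions using (Injective)
open import Relation.Nullary using (yes; no)
open import Relation.Binary.PropositionalEquality using (_≡_; _≢_; refl; sym; trans; cong)
open import Relation.Binary.Definitions using (DecidableEquality)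

⊨QF-cong : ∀ {ni nₒ V} {Π Π' : Assignment ni nₒ V} → (∀ v → Π v ≡ Π' v) →
           ∀ {i} (ψ : QF ni nₒ V) → Π , i ⊨QF ψ → Π' , i ⊨QF ψ
⊨QF-cong Π≗Π' (atom a π) holds rewrite Π≗Π' π = holds
⊨QF-cong Π≗Π' (¬' ψ) fails holds' = fails (⊨QF-cong (sym ∘ Π≗Π') ψ holds')
⊨QF-cong Π≗Π' (ψ ∨' χ) (inj₁ holds) = inj₁ (⊨QF-cong Π≗Π' ψ holds)
⊨QF-cong Π≗Π' (ψ ∨' χ) (inj₂ holds) = inj₂ (⊨QF-cong Π≗Π' χ holds)
⊨QF-cong Π≗Π' (X' ψ) holds = ⊨QF-cong Π≗Π' ψ holds
⊨QF-cong Π≗Π' (ψ U' χ) (j , i≤j , χ-at-j , ψ-before) =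
  j , i≤j , ⊨QF-cong Π≗Π' χ χ-at-j , λ k i≤k k<j → ⊨QF-cong Π≗Π' ψ (ψ-before k i≤k k<j)

module Blocks {ni nₒ : ℕ} {V : Set} (_≟_ : DecidableEquality V) where

  update-same : ∀ (Π : Assignment ni nₒ V) π t → (Π [ π ↦ t ]⟨ _≟_ ⟩) π ≡ just t
  update-same Π π t with π ≟ π
  ... | yes _  = refl
  ... | no π≢π = ⊥-elim (π≢π refl)

  update-other : ∀ (Π : Assignment ni nₒ V) {π v} t → v ≢ π → (Π [ π ↦ t ]⟨ _≟_ ⟩) v ≡ Π v
  update-other Π {π} {v} t v≢π with v ≟ π
  ... | yes v≡π = ⊥-elim (v≢π v≡π)
  ... | no _    = refl

  updateBlock : ∀ {k} → Assignment ni nₒ V → (Fin k → V) → (Fin k → Trace ni nₒ) →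
                Assignment ni nₒ V
  updateBlock {zero}  Π ι g = Π
  updateBlock {suc k} Π ι g = updateBlock (Π [ ι zero ↦ g zero ]⟨ _≟_ ⟩) (ι ∘ suc) (g ∘ suc)

  updateBlock-outside : ∀ {k} (Π : Assignment ni nₒ V) (ι : Fin k → V) g {v} →
                        (∀ j → v ≢ ι j) → updateBlock Π ι g v ≡ Π v
  updateBlock-outside {zero}  Π ι g v∉ι = refl
  updateBlock-outside {suc k} Π ι g v∉ι =
    trans (updateBlock-outside _ (ι ∘ suc) (g ∘ suc) (v∉ι ∘ suc))
          (update-other Π (g zero) (v∉ι zero))

  updateBlock-inside : ∀ {k} (Π : Assignment ni nₒ V) {ι : Fin k → V} g →
                       Injective _≡_ _≡_ ι → ∀ j → updateBlock Π ι g (ι j) ≡ just (g j)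
  updateBlock-inside Π {ι} g ι-inj zero =
    trans (updateBlock-outside _ (ι ∘ suc) (g ∘ suc) (λ j ι0≡ιj → 0≢1+n (ι-inj ι0≡ιj)))
          (update-same Π (ι zero) (g zero))
  updateBlock-inside Π g ι-inj (suc j) = updateBlock-inside _ (g ∘ suc) (suc-injective ∘ ι-inj) j

  module _ (Tr : Trace ni nₒ → Set) where

    ∃-block : ∀ {k} {Π : Assignment ni nₒ V} {i} {ψ : HyperLTL ni nₒ V} (ι : Fin k → V) g →
              (∀ j → Tr (g j)) → Sat _≟_ Tr (updateBlock Π ι g) i ψ →
              Sat _≟_ Tr Π i (∃s (tabulate ι) ψ)
    ∃-block {zero}  ι g g∈Tr holds = holds
    ∃-block {suc k} ι g g∈Tr holds =
      g zero , g∈Tr zero , ∃-block (ι ∘ suc) (g ∘ suc) (g∈Tr ∘ suc) holds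

    ∀-block : ∀ {k} {Π : Assignment ni nₒ V} {i} {ψ : HyperLTL ni nₒ V} (ι : Fin k → V) →
              (∀ g → (∀ j → Tr (g j)) → Sat _≟_ Tr (updateBlock Π ι g) i ψ) →
              Sat _≟_ Tr Π i (∀s (tabulate ι) ψ)
    ∀-block {zero}  ι holds = holds (λ ()) (λ ())
    ∀-block {suc k} ι holds t t∈Tr =
      ∀-block (ι ∘ suc) λ g g∈Tr →
        holds (t ∷ g) λ { zero → t∈Tr ; (suc j) → g∈Tr j }

module _ {ni nₒ a b : ℕ} where
  open Blocks {ni} {nₒ} (_≟V_ {a} {b}) public

-- The variables of a quantifier prefix as written in the theorem.
prefixVars : ∀ {A : Set} n (ι : Fin n → A) → map ι (allFin n) ≡ tabulate ι
prefixVars n ι = map-tabulate (λ j → j) ι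

trace∈traces : ∀ {ni nₒ} (S : TS ni nₒ) (w : ℕ → Υ ni) → traces S (trace S w)
trace∈traces S w = w , refl

updateBlocks-⊎ : ∀ {ni nₒ a b} (Π : Assignment ni nₒ (Fin a ⊎ Fin b)) f g v →
                 updateBlock (updateBlock Π inj₁ f) inj₂ g v ≡ [ just ∘ f , just ∘ g ] v
updateBlocks-⊎ Π f g (inj₁ j) =
  trans (updateBlock-outside (updateBlock Π inj₁ f) inj₂ g {inj₁ j} (λ k ()))
        (updateBlock-inside Π f inj₁-injective j)
updateBlocks-⊎ Π f g (inj₂ k) = updateBlock-inside (updateBlock Π inj₁ f) g inj₂-injective k

-- Part (1): a winning strategy σ : (Υⁿ)* → Υᵐ witnesses ∀π₁…∀πₙ ∃π'₁…∃π'ₘ φ.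
-- The ∃-traces answer the ∀-traces ρⱼ = trace(wⱼ) by the traces on the
-- responses of σ to the input words wⱼ.
∀∃-by-strategy : ∀ {ni nₒ : ℕ} (S : TS ni nₒ) (n m : ℕ) (φ : QF ni nₒ (Fin n ⊎ Fin m)) →
    (Σ (Strategy ni n m) λ σ →
      ∀ (u : ℕ → (Fin n → Υ ni)) →
        [ (λ j → just (trace S (λ i → u i j)))
        , (λ k → just (trace S (λ i → response σ u i k))) ] , 0 ⊨QF φ) →
    S ⊨ ∀s (map inj₁ (allFin n)) (∃s (map inj₂ (allFin m)) (qf φ)) ⟨ _≟V_ ⟩
∀∃-by-strategy {ni} {nₒ} S n m φ (σ , wins)
  rewrite prefixVars n (inj₁ {B = Fin m}) | prefixVars m (inj₂ {A = Fin n}) =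
  ∀-block (traces S) inj₁ answer
  where
  answer : (ρ : Fin n → Trace ni nₒ) → (∀ j → traces S (ρ j)) →
           Sat _≟V_ (traces S) (updateBlock emptyAssignment inj₁ ρ) 0
               (∃s (tabulate inj₂) (qf φ))
  answer ρ ρ∈S = ∃-block (traces S) inj₂ ρ' (λ k → trace∈traces S (v k))
                   (⊨QF-cong matches φ (wins u))
    where
    -- the input words of the ∀-traces, read as one word over Υⁿ
    u : ℕ → Fin n → Υ ni
    u i j = proj₁ (ρ∈S j) i

    v : Fin m → ℕ → Υ ni
    v k i = response σ u i k

    ρ' : Fin m → Trace ni nₒ
    ρ' k = trace S (v k)

    matches : ∀ x → [ (λ j → just (trace S (λ i → u i j))) , just ∘ ρ' ] x
                  ≡ updateBlock (updateBlock emptyAssignment inj₁ ρ) inj₂ ρ' x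
    matches (inj₁ j) = trans (cong just (sym (proj₂ (ρ∈S j))))
                             (sym (updateBlocks-⊎ emptyAssignment ρ ρ' (inj₁ j)))
    matches (inj₂ k) = sym (updateBlocks-⊎ emptyAssignment ρ ρ' (inj₂ k))

-- Part (2): a strategy σ : (Υ⁰)* → Υᵐ, i.e. a fixed word over Υᵐ, witnesses
-- ∃π₁…∃πₘ ∀π'₁…∀π'ₙ φ by the traces on that word.
∃∀-by-strategy : ∀ {ni nₒ : ℕ} (S : TS ni nₒ) (n m : ℕ) (φ : QF ni nₒ (Fin m ⊎ Fin n)) →
    (Σ (Strategy ni 0 m) λ σ →
      ∀ (ρ' : Fin n → Trace ni nₒ) → (∀ j → traces S (ρ' j)) →
        [ (λ k → just (trace S (λ i → play⁰ σ i k)))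
        , (λ j → just (ρ' j)) ] , 0 ⊨QF φ) →
    S ⊨ ∃s (map inj₁ (allFin m)) (∀s (map inj₂ (allFin n)) (qf φ)) ⟨ _≟V_ ⟩
∃∀-by-strategy S n m φ (σ , wins)
  rewrite prefixVars m (inj₁ {B = Fin n}) | prefixVars n (inj₂ {A = Fin m}) =
  ∃-block (traces S) inj₁ ρ (λ k → trace∈traces S (w k)) (∀-block (traces S) inj₂ λ ρ' ρ'∈S →
    ⊨QF-cong (sym ∘ updateBlocks-⊎ emptyAssignment ρ ρ') φ (wins ρ' ρ'∈S))
  where
  w : Fin m → ℕ → Υ _
  w k i = play⁰ σ i k

  ρ : Fin m → Trace _ _
  ρ k = trace S (w k)

theorem4 : ∀ {ni nₒ : ℕ} (S : TS ni nₒ) (n m : ℕ) →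
    ((φ : QF ni nₒ (Fin n ⊎ Fin m)) →
      (Σ (Strategy ni n m) λ σ →
        ∀ (u : ℕ → (Fin n → Υ ni)) →
          [ (λ j → just (trace S (λ i → u i j)))
          , (λ k → just (trace S (λ i → response σ u i k))) ] , 0 ⊨QF φ) →
      S ⊨ ∀s (map inj₁ (allFin n)) (∃s (map inj₂ (allFin m)) (qf φ)) ⟨ _≟V_ ⟩)
    ×
    ((φ : QF ni nₒ (Fin m ⊎ Fin n)) →
      (Σ (Strategy ni 0 m) λ σ →
        ∀ (ρ' : Fin n → Trace ni nₒ) → (∀ j → traces S (ρ' j)) →
          [ (λ k → just (trace S (λ i → play⁰ σ i k)))
          , (λ j → just (ρ' j)) ] , 0 ⊨QF φ) →
      S ⊨ ∃s (map inj₁ (allFin m)) (∀s (map inj₂ (allFin n)) (qf φ)) ⟨ _≟V_ ⟩)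
theorem4 S n m = ∀∃-by-strategy S n m , ∃∀-by-strategy S n m
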